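{- A superintuitionistic logic $L$ is positively defined if and only if the corresponding variety $V_L$ of Heyting algebras is B-saturated.
   Context: Formulas are built from a countable set of propositional variables using $\land,\lor,\to$ and the constant $\bot$. Positive formulas are those not containing $\bot$. A superintuitionistic (si-)logic is a set of formulas containing the intuitionistic propositional theorems $\mathrm{Int}$ and closed under modus ponens and substitutions. It is positively defined if it equals the least si-logic containing $\mathrm{Int}\cup\Gamma$ for some (possibly infinite) set $\Gamma$ of positive formulas. Heyting algebras are Brouwerian algebras $(A,\land,\lor,\to,1)$ (distributive lattice with top and relative pseudo-complementation) with a least element $0$ as a constant. $V_L$ is the variety of Heyting algebras in which all formulas of $L$ are valid. For a Heyting algebra $A$, $A^+$ is its $\{\land,\lor,\to,1\}$-reduct. A Heyting algebra $A$ is B-embedded in a Heyting algebra $C$ if $A^+$ embeds into $C^+$ as a Brouwerian algebra. A variety $V$ of Heyting algebras is B-saturated if every Heyting algebra B-embedded in some member of $V$ belongs to $V$. -}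

module Defs where

open import Level using (Level; _⊔_; Setω)
open import Data.Nat using (ℕ)
open import Data.Sum using (_⊎_)
open import Data.Product using (Σ; _×_)
open import Relation.Binary.Lattice.Bundles using (HeytingAlgebra)

infixr 5 _⇒_
infixr 6 _∨_
infixr 7 _∧_

data Fm : Set where
  var : ℕ → Fm
  _∧_ _∨_ _⇒_ : Fm → Fm → Fm
  ⊥ : Fm

data Positive : Fm → Set where
  var : ∀ n → Positive (var n)
  _∧_ : ∀ {φ ψ} → Positive φ → Positive ψ → Positive (φ ∧ ψ)
  _∨_ : ∀ {φ ψ} → Positive φ → Positive ψ → Positive (φ ∨ ψ)
  _⇒_ : ∀ {φ ψ} → Positive φ → Positive ψ → Positive (φ ⇒ ψ)

Subst : Set
Subst = ℕ → Fm

_[_] : Fm → Subst → Fm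
var n [ σ ] = σ n
(φ ∧ ψ) [ σ ] = (φ [ σ ]) ∧ (ψ [ σ ])
(φ ∨ ψ) [ σ ] = (φ [ σ ]) ∨ (ψ [ σ ])
(φ ⇒ ψ) [ σ ] = (φ [ σ ]) ⇒ (ψ [ σ ])
⊥ [ σ ] = ⊥

FmSet : Set₁
FmSet = Fm → Set

_⊆_ : FmSet → FmSet → Set
X ⊆ Y = ∀ {φ} → X φ → Y φ

_≐_ : FmSet → FmSet → Set
X ≐ Y = (X ⊆ Y) × (Y ⊆ X)

data Closure (X : FmSet) : FmSet where
  base  : ∀ {φ} → X φ → Closure X φ
  mp    : ∀ {φ ψ} → Closure X φ → Closure X (φ ⇒ ψ) → Closure X ψ
  subst : ∀ {φ} (σ : Subst) → Closure X φ → Closure X (φ [ σ ])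

-- Standard Hilbert-style axioms of intuitionistic propositional logic
-- (with the substitution rule of Closure they act as schemes)
p q r : Fm
p = var 0
q = var 1
r = var 2

data IntAx : FmSet where
  ax1 : IntAx (p ⇒ q ⇒ p)
  ax2 : IntAx ((p ⇒ q ⇒ r) ⇒ (p ⇒ q) ⇒ p ⇒ r)
  ax3 : IntAx (p ∧ q ⇒ p)
  ax4 : IntAx (p ∧ q ⇒ q)
  ax5 : IntAx (p ⇒ q ⇒ p ∧ q)
  ax6 : IntAx (p ⇒ p ∨ q)
  ax7 : IntAx (q ⇒ p ∨ q)
  ax8 : IntAx ((p ⇒ r) ⇒ (q ⇒ r) ⇒ p ∨ q ⇒ r)
  ax9 : IntAx (⊥ ⇒ p)

Int : FmSet
Int = Closure IntAx

record SiLogic (L : FmSet) : Set where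
  field
    containsInt : Int ⊆ L
    closedMP    : ∀ {φ ψ} → L φ → L (φ ⇒ ψ) → L ψ
    closedSubst : ∀ {φ} (σ : Subst) → L φ → L (φ [ σ ])

_⊕_ : FmSet → FmSet → FmSet
(A ⊕ Γ) = Closure (λ φ → A φ ⊎ Γ φ)

PositivelyDefined : FmSet → Set₁
PositivelyDefined L =
  Σ FmSet (λ Γ → (Γ ⊆ Positive) × (L ≐ (Int ⊕ Γ)))

module _ {c ℓ₁ ℓ₂ : Level} (A : HeytingAlgebra c ℓ₁ ℓ₂) where
  private module A = HeytingAlgebra A

  ⟦_⟧ : Fm → (ℕ → A.Carrier) → A.Carrier
  ⟦ var n ⟧ v = v n
  ⟦ φ ∧ ψ ⟧ v = ⟦ φ ⟧ v A.∧ ⟦ ψ ⟧ v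
  ⟦ φ ∨ ψ ⟧ v = ⟦ φ ⟧ v A.∨ ⟦ ψ ⟧ v
  ⟦ φ ⇒ ψ ⟧ v = ⟦ φ ⟧ v A.⇨ ⟦ ψ ⟧ v
  ⟦ ⊥ ⟧ v = A.⊥

  Valid : Fm → Set (c ⊔ ℓ₁)
  Valid φ = ∀ (v : ℕ → A.Carrier) → ⟦ φ ⟧ v A.≈ A.⊤

  -- A ∈ V_L : every formula of L is valid in A
  InV : FmSet → Set (c ⊔ ℓ₁)
  InV L = ∀ {φ} → L φ → Valid φ

-- A is B-embedded in C: an embedding of the Brouwerian reducts,
-- i.e. an injective map preserving ∧, ∨, →, 1 (0 need not be preserved).
record BEmbedding {a a₁ a₂ c c₁ c₂ : Level}
       (A : HeytingAlgebra a a₁ a₂) (C : HeytingAlgebra c c₁ c₂)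
       : Set (a ⊔ a₁ ⊔ c ⊔ c₁) where
  private
    module A = HeytingAlgebra A
    module C = HeytingAlgebra C
  field
    f       : A.Carrier → C.Carrier
    cong    : ∀ {x y} → x A.≈ y → f x C.≈ f y
    inj     : ∀ {x y} → f x C.≈ f y → x A.≈ y
    pres-∧  : ∀ x y → f (x A.∧ y) C.≈ (f x C.∧ f y)
    pres-∨  : ∀ x y → f (x A.∨ y) C.≈ (f x C.∨ f y)
    pres-⇨  : ∀ x y → f (x A.⇨ y) C.≈ (f x C.⇨ f y)
    pres-⊤  : f A.⊤ C.≈ C.⊤

BSaturated : FmSet → Setω
BSaturated L =
  ∀ {a a₁ a₂ c c₁ c₂ : Level}
    (A : HeytingAlgebra a a₁ a₂) (C : HeytingAlgebra c c₁ c₂) →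
    InV C L → BEmbedding A C → InV A L

record _⇔ω_ (P : Set₁) (Q : Setω) : Setω where
  field
    to   : P → Q
    from : Q → P

module Submission where

-- (⇒) Int holds in every Heyting algebra, and a B-embedding f : A → C commutes
--     with the evaluation of positive formulas; being injective it therefore
--     reflects their validity.  So if L = Int ⊕ Γ with Γ positive and C ∈ V_L,
--     every axiom of L is valid in A, hence so is all of L.
-- (⇐) Put L⁺ = Int ⊕ (L ∩ Positive) ⊆ L.  The relativization
--     θ φ = φ⟨p₀ ∣ pₙ ↦ p₀ ∨ pₙ₊₁⟩, reading ⊥ as the fresh variable p₀,
--     maps theorems of L⁺ into L (every relativized theorem is provable) and
--     has only positive values; substituting ⊥ back for p₀ shows that it
--     reflects provability as well.  Since θ preserves ∧, ∨, → and ⊤ on the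
--     nose, it is a B-embedding of the Lindenbaum algebra of L⁺ into that of L.
--     The latter lies in V_L, so by saturation so does the former, whence
--     L ⊆ L⁺ and L is defined by the positive formulas L ∩ Positive.

open import Defs
open import Level using (0ℓ)
open import Function using (_∘_)
open import Data.Nat using (zero; suc)
open import Data.Sum using (_⊎_; inj₁; inj₂)
open import Data.Product using (_×_; _,_; proj₁; proj₂; swap)
open import Relation.Binary.Lattice.Bundles using (HeytingAlgebra)
import Relation.Binary.PropositionalEquality as PE
open PE using (_≡_; cong₂; module ≡-Reasoning)
import Relation.Binary.Lattice.Properties.HeytingAlgebra as HeytingProps
import Relation.Binary.Lattice.Properties.MeetSemilattice as MeetProps
import Relation.Binary.Lattice.Properties.JoinSemilattice as JoinProps
import Relation.Binary.Lattice.Properties.BoundedJoinSemilattice as BoundedJoinProps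

[var] : ∀ φ → φ [ var ] ≡ φ
[var] (var n) = PE.refl
[var] (φ ∧ ψ) = cong₂ _∧_ ([var] φ) ([var] ψ)
[var] (φ ∨ ψ) = cong₂ _∨_ ([var] φ) ([var] ψ)
[var] (φ ⇒ ψ) = cong₂ _⇒_ ([var] φ) ([var] ψ)
[var] ⊥ = PE.refl

_⟨_∣_⟩ : Fm → Fm → Subst → Fm
var n ⟨ b ∣ σ ⟩ = σ n
(φ ∧ ψ) ⟨ b ∣ σ ⟩ = φ ⟨ b ∣ σ ⟩ ∧ ψ ⟨ b ∣ σ ⟩
(φ ∨ ψ) ⟨ b ∣ σ ⟩ = φ ⟨ b ∣ σ ⟩ ∨ ψ ⟨ b ∣ σ ⟩
(φ ⇒ ψ) ⟨ b ∣ σ ⟩ = φ ⟨ b ∣ σ ⟩ ⇒ ψ ⟨ b ∣ σ ⟩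
⊥ ⟨ b ∣ σ ⟩ = b

⟨⟩-positive : ∀ {b σ φ} → Positive φ → φ ⟨ b ∣ σ ⟩ ≡ φ [ σ ]
⟨⟩-positive (var n) = PE.refl
⟨⟩-positive (φ ∧ ψ) = cong₂ _∧_ (⟨⟩-positive φ) (⟨⟩-positive ψ)
⟨⟩-positive (φ ∨ ψ) = cong₂ _∨_ (⟨⟩-positive φ) (⟨⟩-positive ψ)
⟨⟩-positive (φ ⇒ ψ) = cong₂ _⇒_ (⟨⟩-positive φ) (⟨⟩-positive ψ)

⟨⊥⟩ : ∀ {σ} φ → φ ⟨ ⊥ ∣ σ ⟩ ≡ φ [ σ ]
⟨⊥⟩ (var n) = PE.refl
⟨⊥⟩ (φ ∧ ψ) = cong₂ _∧_ (⟨⊥⟩ φ) (⟨⊥⟩ ψ)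
⟨⊥⟩ (φ ∨ ψ) = cong₂ _∨_ (⟨⊥⟩ φ) (⟨⊥⟩ ψ)
⟨⊥⟩ (φ ⇒ ψ) = cong₂ _⇒_ (⟨⊥⟩ φ) (⟨⊥⟩ ψ)
⟨⊥⟩ ⊥ = PE.refl

⟨⟩-[] : ∀ {b σ} τ φ → (φ [ τ ]) ⟨ b ∣ σ ⟩ ≡ φ ⟨ b ∣ (λ n → τ n ⟨ b ∣ σ ⟩) ⟩
⟨⟩-[] τ (var n) = PE.refl
⟨⟩-[] τ (φ ∧ ψ) = cong₂ _∧_ (⟨⟩-[] τ φ) (⟨⟩-[] τ ψ)
⟨⟩-[] τ (φ ∨ ψ) = cong₂ _∨_ (⟨⟩-[] τ φ) (⟨⟩-[] τ ψ)
⟨⟩-[] τ (φ ⇒ ψ) = cong₂ _⇒_ (⟨⟩-[] τ φ) (⟨⟩-[] τ ψ)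
⟨⟩-[] τ ⊥ = PE.refl

[]-⟨⟩ : ∀ {b σ} τ φ → (φ ⟨ b ∣ σ ⟩) [ τ ] ≡ φ ⟨ b [ τ ] ∣ (λ n → σ n [ τ ]) ⟩
[]-⟨⟩ τ (var n) = PE.refl
[]-⟨⟩ τ (φ ∧ ψ) = cong₂ _∧_ ([]-⟨⟩ τ φ) ([]-⟨⟩ τ ψ)
[]-⟨⟩ τ (φ ∨ ψ) = cong₂ _∨_ ([]-⟨⟩ τ φ) ([]-⟨⟩ τ ψ)
[]-⟨⟩ τ (φ ⇒ ψ) = cong₂ _⇒_ ([]-⟨⟩ τ φ) ([]-⟨⟩ τ ψ)
[]-⟨⟩ τ ⊥ = PE.refl

⟨⟩-isPositive : ∀ {b σ} → Positive b → (∀ n → Positive (σ n)) →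
                ∀ φ → Positive (φ ⟨ b ∣ σ ⟩)
⟨⟩-isPositive pb pσ (var n) = pσ n
⟨⟩-isPositive pb pσ (φ ∧ ψ) = ⟨⟩-isPositive pb pσ φ ∧ ⟨⟩-isPositive pb pσ ψ
⟨⟩-isPositive pb pσ (φ ∨ ψ) = ⟨⟩-isPositive pb pσ φ ∨ ⟨⟩-isPositive pb pσ ψ
⟨⟩-isPositive pb pσ (φ ⇒ ψ) = ⟨⟩-isPositive pb pσ φ ⇒ ⟨⟩-isPositive pb pσ ψ
⟨⟩-isPositive pb pσ ⊥ = pb

module Semantics {c ℓ₁ ℓ₂} (H : HeytingAlgebra c ℓ₁ ℓ₂) where
  open HeytingAlgebra H renaming (_∧_ to _⊓_; _∨_ to _⊔_; ⊤ to 𝟙; ⊥ to 𝟘)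
  open HeytingProps H using (⇨-cong; ⇨-eval; y≤x⇨y; ⇨-distribˡ-∨-∧-≥)
  open MeetProps meetSemilattice using (∧-cong)
  open JoinProps joinSemilattice using (∨-cong)

  ⟦⟧-cong : ∀ φ {v w} → (∀ n → v n ≈ w n) → ⟦_⟧ H φ v ≈ ⟦_⟧ H φ w
  ⟦⟧-cong (var n) v≈w = v≈w n
  ⟦⟧-cong (φ ∧ ψ) v≈w = ∧-cong (⟦⟧-cong φ v≈w) (⟦⟧-cong ψ v≈w)
  ⟦⟧-cong (φ ∨ ψ) v≈w = ∨-cong (⟦⟧-cong φ v≈w) (⟦⟧-cong ψ v≈w)
  ⟦⟧-cong (φ ⇒ ψ) v≈w = ⇨-cong (⟦⟧-cong φ v≈w) (⟦⟧-cong ψ v≈w)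
  ⟦⟧-cong ⊥ v≈w = Eq.refl

  ⟦⟧-subst : ∀ φ σ v → ⟦_⟧ H (φ [ σ ]) v ≡ ⟦_⟧ H φ (λ n → ⟦_⟧ H (σ n) v)
  ⟦⟧-subst (var n) σ v = PE.refl
  ⟦⟧-subst (φ ∧ ψ) σ v = cong₂ _⊓_ (⟦⟧-subst φ σ v) (⟦⟧-subst ψ σ v)
  ⟦⟧-subst (φ ∨ ψ) σ v = cong₂ _⊔_ (⟦⟧-subst φ σ v) (⟦⟧-subst ψ σ v)
  ⟦⟧-subst (φ ⇒ ψ) σ v = cong₂ _⇨_ (⟦⟧-subst φ σ v) (⟦⟧-subst ψ σ v)
  ⟦⟧-subst ⊥ σ v = PE.refl

  ≤⇒⇨≈⊤ : ∀ {x y} → x ≤ y → (x ⇨ y) ≈ 𝟙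
  ≤⇒⇨≈⊤ x≤y = antisym (maximum _) (transpose-⇨ (trans (x∧y≤y _ _) x≤y))

  ⇨≈⊤⇒≤ : ∀ {x y} → (x ⇨ y) ≈ 𝟙 → x ≤ y
  ⇨≈⊤⇒≤ x⇨y≈⊤ =
    trans (∧-greatest (trans (maximum _) (reflexive (Eq.sym x⇨y≈⊤))) refl) ⇨-eval

  ⇨-apply : ∀ {w x y} → w ≤ (x ⇨ y) → w ≤ x → w ≤ y
  ⇨-apply w≤x⇨y w≤x = trans (∧-greatest w≤x⇨y w≤x) ⇨-eval

  intAx-valid : ∀ {φ} → IntAx φ → Valid H φ
  intAx-valid ax1 v = ≤⇒⇨≈⊤ y≤x⇨y
  intAx-valid ax2 v = ≤⇒⇨≈⊤ (transpose-⇨ (transpose-⇨ (⇨-apply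
    (⇨-apply (trans (x∧y≤x _ _) (x∧y≤x _ _)) (x∧y≤y _ _))
    (⇨-apply (trans (x∧y≤x _ _) (x∧y≤y _ _)) (x∧y≤y _ _)))))
  intAx-valid ax3 v = ≤⇒⇨≈⊤ (x∧y≤x _ _)
  intAx-valid ax4 v = ≤⇒⇨≈⊤ (x∧y≤y _ _)
  intAx-valid ax5 v = ≤⇒⇨≈⊤ (transpose-⇨ refl)
  intAx-valid ax6 v = ≤⇒⇨≈⊤ (x≤x∨y _ _)
  intAx-valid ax7 v = ≤⇒⇨≈⊤ (y≤x∨y _ _)
  intAx-valid ax8 v = ≤⇒⇨≈⊤ (transpose-⇨ (⇨-distribˡ-∨-∧-≥ _ _ _))
  intAx-valid ax9 v = ≤⇒⇨≈⊤ (minimum _)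

  closure-valid : ∀ {X : FmSet} → (∀ {φ} → X φ → Valid H φ) → InV H (Closure X)
  closure-valid valid (base x) = valid x
  closure-valid valid (mp dφ dφ⇒ψ) v =
    antisym (maximum _)
      (trans (reflexive (Eq.sym (closure-valid valid dφ v)))
             (⇨≈⊤⇒≤ (closure-valid valid dφ⇒ψ v)))
  closure-valid valid (subst {φ} σ dφ) v =
    PE.subst (_≈ 𝟙) (PE.sym (⟦⟧-subst φ σ v)) (closure-valid valid dφ _)

  Int-valid : InV H Int
  Int-valid = closure-valid intAx-valid

module _ {a a₁ a₂ c c₁ c₂} {A : HeytingAlgebra a a₁ a₂} {C : HeytingAlgebra c c₁ c₂}
         (e : BEmbedding A C) where
  private module C = HeytingAlgebra C
  open BEmbedding e

  embed-positive : ∀ {φ} → Positive φ → ∀ v → f (⟦_⟧ A φ v) C.≈ ⟦_⟧ C φ (f ∘ v)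
  embed-positive (var n) v = C.Eq.refl
  embed-positive (φ ∧ ψ) v = C.Eq.trans (pres-∧ _ _)
    (MeetProps.∧-cong C.meetSemilattice (embed-positive φ v) (embed-positive ψ v))
  embed-positive (φ ∨ ψ) v = C.Eq.trans (pres-∨ _ _)
    (JoinProps.∨-cong C.joinSemilattice (embed-positive φ v) (embed-positive ψ v))
  embed-positive (φ ⇒ ψ) v = C.Eq.trans (pres-⇨ _ _)
    (HeytingProps.⇨-cong C (embed-positive φ v) (embed-positive ψ v))

  positive-reflect : ∀ {φ} → Positive φ → Valid C φ → Valid A φ
  positive-reflect pφ valid v =
    inj (C.Eq.trans (embed-positive pφ v) (C.Eq.trans (valid (f ∘ v)) (C.Eq.sym pres-⊤)))

inst : Fm → Fm → Fm → Subst
inst φ ψ χ zero = φ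
inst φ ψ χ (suc zero) = ψ
inst φ ψ χ (suc (suc _)) = χ

-- A fixed theorem of Int, serving as the top element of Lindenbaum algebras.
⊤Fm : Fm
⊤Fm = ⊥ ⇒ ⊥

module Derivable {M : FmSet} (SM : SiLogic M) where
  open SiLogic SM

  axiom : ∀ {φ} → IntAx φ → ∀ σ → M (φ [ σ ])
  axiom ax σ = closedSubst σ (containsInt (base ax))

  ⇒-refl : ∀ φ → M (φ ⇒ φ)
  ⇒-refl φ = closedMP (axiom ax1 (inst φ φ φ))
    (closedMP (axiom ax1 (inst φ (φ ⇒ φ) φ)) (axiom ax2 (inst φ (φ ⇒ φ) φ)))

  ⇒-weaken : ∀ {φ ψ} → M ψ → M (φ ⇒ ψ)
  ⇒-weaken {φ} {ψ} ⊢ψ = closedMP ⊢ψ (axiom ax1 (inst ψ φ ψ))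

  mp-under : ∀ {φ ψ χ} → M (χ ⇒ φ ⇒ ψ) → M (χ ⇒ φ) → M (χ ⇒ ψ)
  mp-under {φ} {ψ} {χ} h₁ h₂ = closedMP h₂ (closedMP h₁ (axiom ax2 (inst χ φ ψ)))

  ⇒-trans : ∀ {φ ψ χ} → M (φ ⇒ ψ) → M (ψ ⇒ χ) → M (φ ⇒ χ)
  ⇒-trans h₁ h₂ = mp-under (⇒-weaken h₂) h₁

  ∧-intro : ∀ {φ ψ χ} → M (χ ⇒ φ) → M (χ ⇒ ψ) → M (χ ⇒ φ ∧ ψ)
  ∧-intro {φ} {ψ} {χ} h₁ h₂ = mp-under (⇒-trans h₁ (axiom ax5 (inst φ ψ χ))) h₂

  ∨-elim : ∀ {φ ψ χ} → M (φ ⇒ χ) → M (ψ ⇒ χ) → M (φ ∨ ψ ⇒ χ)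
  ∨-elim {φ} {ψ} {χ} h₁ h₂ = closedMP h₂ (closedMP h₁ (axiom ax8 (inst φ ψ χ)))

  curry : ∀ {φ ψ χ} → M (χ ∧ φ ⇒ ψ) → M (χ ⇒ φ ⇒ ψ)
  curry {φ} {ψ} {χ} h =
    ⇒-trans (axiom ax5 (inst χ φ χ)) (closedMP (⇒-weaken {φ} h) (axiom ax2 (inst φ (χ ∧ φ) ψ)))

  uncurry : ∀ {φ ψ χ} → M (χ ⇒ φ ⇒ ψ) → M (χ ∧ φ ⇒ ψ)
  uncurry {φ} {ψ} {χ} h = mp-under (⇒-trans (axiom ax3 (inst χ φ χ)) h) (axiom ax4 (inst χ φ χ))

  ⊢⊤ : M ⊤Fm
  ⊢⊤ = ⇒-refl ⊥

module Lindenbaum {M : FmSet} (SM : SiLogic M) where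
  open SiLogic SM
  open Derivable SM

  _≈M_ : Fm → Fm → Set
  φ ≈M ψ = M (φ ⇒ ψ) × M (ψ ⇒ φ)

  Lind : HeytingAlgebra 0ℓ 0ℓ 0ℓ
  Lind = record
    { Carrier = Fm
    ; _≈_ = _≈M_
    ; _≤_ = λ φ ψ → M (φ ⇒ ψ)
    ; _∨_ = _∨_
    ; _∧_ = _∧_
    ; _⇨_ = _⇒_
    ; ⊤ = ⊤Fm
    ; ⊥ = ⊥
    ; isHeytingAlgebra = record
      { isBoundedLattice = record
        { isLattice = record
          { isPartialOrder = record
            { isPreorder = record
              { isEquivalence = record
                { refl = ⇒-refl _ , ⇒-refl _
                ; sym = swap
                ; trans = λ (h₁ , h₁') (h₂ , h₂') → ⇒-trans h₁ h₂ , ⇒-trans h₂' h₁' }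
              ; reflexive = proj₁
              ; trans = ⇒-trans }
            ; antisym = _,_ }
          ; supremum = λ φ ψ → axiom ax6 (inst φ ψ φ) , axiom ax7 (inst φ ψ φ) , λ _ → ∨-elim
          ; infimum = λ φ ψ → axiom ax3 (inst φ ψ φ) , axiom ax4 (inst φ ψ φ) , λ _ → ∧-intro }
        ; maximum = λ _ → ⇒-weaken ⊢⊤
        ; minimum = λ φ → axiom ax9 (inst φ φ φ) }
      ; exponential = λ _ _ _ → curry , uncurry } }

  ⟦⟧-Lind : ∀ φ v → ⟦_⟧ Lind φ v ≡ φ [ v ]
  ⟦⟧-Lind (var n) v = PE.refl
  ⟦⟧-Lind (φ ∧ ψ) v = cong₂ _∧_ (⟦⟧-Lind φ v) (⟦⟧-Lind ψ v)
  ⟦⟧-Lind (φ ∨ ψ) v = cong₂ _∨_ (⟦⟧-Lind φ v) (⟦⟧-Lind ψ v)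
  ⟦⟧-Lind (φ ⇒ ψ) v = cong₂ _⇒_ (⟦⟧-Lind φ v) (⟦⟧-Lind ψ v)
  ⟦⟧-Lind ⊥ v = PE.refl

  Lind-model : InV Lind M
  Lind-model {φ} ⊢φ v =
    PE.subst (_≈M ⊤Fm) (PE.sym (⟦⟧-Lind φ v)) (⇒-weaken ⊢⊤ , ⇒-weaken (closedSubst v ⊢φ))

  -- ... and validates nothing beyond M (look at the identity valuation).
  Lind-complete : ∀ {φ} → Valid Lind φ → M φ
  Lind-complete {φ} valid =
    closedMP ⊢⊤ (PE.subst (λ ψ → M (⊤Fm ⇒ ψ)) (PE.trans (⟦⟧-Lind φ var) ([var] φ))
      (proj₂ (valid var)))

  ⊥∨-equivalent : ∀ φ → (φ [ (λ n → ⊥ ∨ var n) ]) ≈M φ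
  ⊥∨-equivalent φ =
    PE.subst₂ _≈M_ (⟦⟧-Lind φ _) (PE.trans (⟦⟧-Lind φ var) ([var] φ))
      (Semantics.⟦⟧-cong Lind φ (λ n → BoundedJoinProps.identityˡ boundedJoinSemilattice (var n)))
    where open HeytingAlgebra Lind using (boundedJoinSemilattice)

-- Relativizing proofs: for a si-logic M and a formula b, call σ b-bounded if
-- M ⊢ b → σ n for every n.  Relativizations of theorems are then provable in M.
module Relativization {M : FmSet} (SM : SiLogic M) (b : Fm) where
  open SiLogic SM
  open Derivable SM

  Bounded : Subst → Set
  Bounded σ = ∀ n → M (b ⇒ σ n)

  -- b implies every relativization along a b-bounded σ; this keeps
  -- b-boundedness stable under composing with substitutions.
  ⟨⟩-bounded : ∀ {σ} → Bounded σ → ∀ φ → M (b ⇒ φ ⟨ b ∣ σ ⟩)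
  ⟨⟩-bounded bσ (var n) = bσ n
  ⟨⟩-bounded bσ (φ ∧ ψ) = ∧-intro (⟨⟩-bounded bσ φ) (⟨⟩-bounded bσ ψ)
  ⟨⟩-bounded {σ} bσ (φ ∨ ψ) =
    ⇒-trans (⟨⟩-bounded bσ φ) (axiom ax6 (inst (φ ⟨ b ∣ σ ⟩) (ψ ⟨ b ∣ σ ⟩) b))
  ⟨⟩-bounded {σ} bσ (φ ⇒ ψ) =
    ⇒-trans (⟨⟩-bounded bσ ψ) (axiom ax1 (inst (ψ ⟨ b ∣ σ ⟩) (φ ⟨ b ∣ σ ⟩) b))
  ⟨⟩-bounded bσ ⊥ = ⇒-refl b

  Relativizes : FmSet → Set
  Relativizes X = ∀ {φ} → X φ → ∀ {σ} → Bounded σ → M (φ ⟨ b ∣ σ ⟩)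

  closure-relativizes : ∀ {X} → Relativizes X → Relativizes (Closure X)
  closure-relativizes rel (base x) bσ = rel x bσ
  closure-relativizes rel (mp dφ dφ⇒ψ) bσ =
    closedMP (closure-relativizes rel dφ bσ) (closure-relativizes rel dφ⇒ψ bσ)
  closure-relativizes rel (subst {φ} τ dφ) bσ =
    PE.subst M (PE.sym (⟨⟩-[] τ φ))
      (closure-relativizes rel dφ (λ n → ⟨⟩-bounded bσ (τ n)))

  -- Axiom ax9 becomes b → σ 0; all other axioms are positive.
  intAx-relativizes : Relativizes IntAx
  intAx-relativizes ax1 {σ} _ = axiom ax1 σ
  intAx-relativizes ax2 {σ} _ = axiom ax2 σ
  intAx-relativizes ax3 {σ} _ = axiom ax3 σ
  intAx-relativizes ax4 {σ} _ = axiom ax4 σ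
  intAx-relativizes ax5 {σ} _ = axiom ax5 σ
  intAx-relativizes ax6 {σ} _ = axiom ax6 σ
  intAx-relativizes ax7 {σ} _ = axiom ax7 σ
  intAx-relativizes ax8 {σ} _ = axiom ax8 σ
  intAx-relativizes ax9 bσ = bσ 0

  positive-extension-relativizes : ∀ {Γ} → Γ ⊆ Positive → Γ ⊆ M → Relativizes (Int ⊕ Γ)
  positive-extension-relativizes {Γ} pos ⊆M = closure-relativizes axioms
    where
    axioms : Relativizes (λ φ → Int φ ⊎ Γ φ)
    axioms (inj₁ ⊢φ) = closure-relativizes intAx-relativizes ⊢φ
    axioms (inj₂ γ) {σ} _ = PE.subst M (PE.sym (⟨⟩-positive (pos γ))) (closedSubst σ (⊆M γ))

module PositivePart {L : FmSet} (SL : SiLogic L) where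
  open SiLogic SL

  L∩Positive : FmSet
  L∩Positive φ = L φ × Positive φ

  L⁺ : FmSet
  L⁺ = Int ⊕ L∩Positive

  SL⁺ : SiLogic L⁺
  SL⁺ = record { containsInt = base ∘ inj₁ ; closedMP = mp ; closedSubst = subst }

  L⁺⊆L : L⁺ ⊆ L
  L⁺⊆L (base (inj₁ ⊢φ)) = containsInt ⊢φ
  L⁺⊆L (base (inj₂ (⊢φ , _))) = ⊢φ
  L⁺⊆L (mp dφ dφ⇒ψ) = closedMP (L⁺⊆L dφ) (L⁺⊆L dφ⇒ψ)
  L⁺⊆L (subst σ dφ) = closedSubst σ (L⁺⊆L dφ)

  private
    module D = Derivable SL
    module D⁺ = Derivable SL⁺
    module Lin = Lindenbaum SL
    module Lin⁺ = Lindenbaum SL⁺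
    open Relativization SL (var 0)

  shift : Subst
  shift n = var 0 ∨ var (suc n)

  θ : Fm → Fm
  θ φ = φ ⟨ var 0 ∣ shift ⟩

  θ-positive : ∀ φ → Positive (θ φ)
  θ-positive = ⟨⟩-isPositive (var 0) (λ n → var 0 ∨ var (suc n))

  θ-sound : ∀ {φ} → L⁺ φ → L (θ φ)
  θ-sound dφ = positive-extension-relativizes proj₂ proj₁ dφ
    (λ n → D.axiom ax6 (inst (var 0) (var (suc n)) (var 0)))

  unshift : Subst
  unshift zero = ⊥
  unshift (suc n) = var n

  θ-unshift : ∀ φ → θ φ [ unshift ] ≡ φ [ (λ n → ⊥ ∨ var n) ]
  θ-unshift φ = begin
    θ φ [ unshift ]                       ≡⟨ []-⟨⟩ unshift φ ⟩
    φ ⟨ ⊥ ∣ (λ n → ⊥ ∨ var n) ⟩           ≡⟨ ⟨⊥⟩ φ ⟩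
    φ [ (λ n → ⊥ ∨ var n) ]               ∎
    where open ≡-Reasoning

  -- If L ⊢ θ φ → θ ψ then, the formula being positive, it lies in L⁺;
  -- unshifting gives L⁺ ⊢ φ[⊥ ∨ p] → ψ[⊥ ∨ p], which is equivalent to φ → ψ.
  θ-reflect : ∀ φ ψ → L (θ φ ⇒ θ ψ) → L⁺ (φ ⇒ ψ)
  θ-reflect φ ψ ⊢θφ⇒θψ =
    D⁺.⇒-trans (proj₂ (Lin⁺.⊥∨-equivalent φ))
      (D⁺.⇒-trans unshifted (proj₁ (Lin⁺.⊥∨-equivalent ψ)))
    where
    unshifted : L⁺ (φ [ (λ n → ⊥ ∨ var n) ] ⇒ ψ [ (λ n → ⊥ ∨ var n) ])
    unshifted = PE.subst L⁺ (θ-unshift (φ ⇒ ψ))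
      (subst unshift (base (inj₂ (⊢θφ⇒θψ , θ-positive (φ ⇒ ψ)))))

  θ-embedding : BEmbedding Lin⁺.Lind Lin.Lind
  θ-embedding = record
    { f = θ
    ; cong = λ (h , h') → θ-sound h , θ-sound h'
    ; inj = λ {φ} {ψ} (h , h') → θ-reflect φ ψ h , θ-reflect ψ φ h'
    ; pres-∧ = λ _ _ → D.⇒-refl _ , D.⇒-refl _
    ; pres-∨ = λ _ _ → D.⇒-refl _ , D.⇒-refl _
    ; pres-⇨ = λ _ _ → D.⇒-refl _ , D.⇒-refl _
    ; pres-⊤ = D.⇒-weaken D.⊢⊤ , D.⇒-weaken (D.⇒-refl (var 0)) }

positivelyDefined⇒BSaturated : ∀ L → PositivelyDefined L → BSaturated L
positivelyDefined⇒BSaturated L (Γ , pos , (L⊆ , ⊆L)) A C C∈V e ⊢φ =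
  Semantics.closure-valid A axioms (L⊆ ⊢φ)
  where
  axioms : ∀ {φ} → Int φ ⊎ Γ φ → Valid A φ
  axioms (inj₁ ⊢φ) = Semantics.Int-valid A ⊢φ
  axioms (inj₂ γ) = positive-reflect e (pos γ) (C∈V (⊆L (base (inj₂ γ))))

BSaturated⇒positivelyDefined : ∀ L → SiLogic L → BSaturated L → PositivelyDefined L
BSaturated⇒positivelyDefined L SL saturated = L∩Positive , proj₂ , (L⊆L⁺ , L⁺⊆L)
  where
  open PositivePart SL
  L⊆L⁺ : L ⊆ L⁺
  L⊆L⁺ ⊢φ = Lindenbaum.Lind-complete SL⁺
    (saturated (Lindenbaum.Lind SL⁺) (Lindenbaum.Lind SL) (Lindenbaum.Lind-model SL) θ-embedding ⊢φ)

mainTheorem13 : (L : FmSet) → SiLogic L → PositivelyDefined L ⇔ω BSaturated L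
mainTheorem13 L SL = record
  { to = positivelyDefined⇒BSaturated L
  ; from = BSaturated⇒positivelyDefined L SL }
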